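{- Every eager-scope $\lambda$-term-graph over $\Sigma^\lambda_{12}$ is fully back-linked.
   Context: Term graphs. A term graph over a signature $\Sigma$ is a tuple $(V,\mathit{lab},\mathit{args},r)$, where: - $\mathit{args}(v)\in V^*$ has length equal to the arity of $\mathit{lab}(v)$; - every vertex is reachable from the root $r$. Write $w\rightarrowtail_kw'$ if $w'$ is the $k$-th entry (from $0$) of $\mathit{args}(w)$, and $w\rightarrowtail w'$ if this holds for some $k$. Notation. $\Sigma^\lambda_{12}=\{@,\lambda,0,S\}$ with arities $2,1,1,2$. For words: $\epsilon$ is empty, juxtaposition is concatenation, $\le$ is the prefix order. $\lambda$-term-graphs. A $\lambda$-term-graph over $\Sigma^\lambda_{12}$ is a term graph over $\Sigma^\lambda_{12}$ admitting $P:V\to V^*$ with: - $P(r)=\epsilon$; - $\lambda$-vertex $w\rightarrowtail_0w_0$ implies $P(w_0)=P(w)w$; - $@$-vertex $w\rightarrowtail_kw_k$ implies $P(w_k)=P(w)$; - $0$-vertex $w$ implies $P(w)\ne\epsilon$; - $0$-vertex $w\rightarrowtail_0w_0$ implies $w_0$ labelled $\lambda$ and $P(w_0)w_0=P(w)$; - $S$-vertex $w\rightarrowtail_0w_0$ implies $P(w_0)v=P(w)$ for some $v$; - $S$-vertex $w\rightarrowtail_1w_1$ implies $w_1$ labelled $\lambda$ and $P(w_1)w_1=P(w)$. Such a $P$ is unique, and is called the abstraction-prefix function of $G$. Eager-scope. $G$ is eager-scope if, for all $w,v\in V$ and $p\in V^*$ with $P(w)=pv$ and $w$ not labelled $S$,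 there exist $n$ and $w=w_0\rightarrowtail w_1\rightarrowtail\cdots\rightarrowtail w_n\rightarrowtail_0 v$ with $w_n$ labelled $0$ and $pv\le P(w_i)$ for $1\le i\le n-1$. Fully back-linked. $G$ is fully back-linked if, for all $w,v\in V$ and $p$ with $P(w)=pv$, there exist $w=w_0\rightarrowtail\cdots\rightarrowtail w_n\rightarrowtail v$ with $pv\le P(w_i)$ for all $0\le i\le n$. -}

module Defs where

open import Data.Nat using (ℕ; zero; suc; _≤_; _<_)
open import Data.Fin using (Fin; toℕ; fromℕ; inject₁)
  renaming (zero to fzero; suc to fsuc)
open import Data.Vec using (Vec; lookup)
open import Data.List using (List; []; _++_; _∷ʳ_)
open import Data.Product using (Σ; ∃; _×_; _,_)
open import Relation.Binary.PropositionalEquality using (_≡_; _≢_)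
open import Relation.Binary.Construct.Closure.ReflexiveTransitive using (Star)
open import Relation.Nullary using (¬_)

data Lab : Set where
  app lam zro succ : Lab

arity : Lab → ℕ
arity app  = 2
arity lam  = 1
arity zro  = 1
arity succ = 2

record TermGraph : Set₁ where
  field
    V     : Set
    lab   : V → Lab
    args  : (v : V) → Vec V (arity (lab v))
    root  : V

  Edge : V → ℕ → V → Set
  Edge w k w' = Σ (Fin (arity (lab w))) λ i → toℕ i ≡ k × lookup (args w) i ≡ w'

  Succ : V → V → Set
  Succ w w' = ∃ λ k → Edge w k w'

  field
    reachable : ∀ v → Star Succ root v

_≼_ : {A : Set} → List A → List A → Set
xs ≼ ys = ∃ λ zs → xs ++ zs ≡ ys

module _ (G : TermGraph) where
  open TermGraph G

  record IsAbsPrefix (P : V → List V) : Set where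
    field
      root-ε   : P root ≡ []
      lam-0    : ∀ w w₀ → lab w ≡ lam → Edge w 0 w₀ → P w₀ ≡ P w ∷ʳ w
      app-k    : ∀ w k wₖ → lab w ≡ app → Edge w k wₖ → P wₖ ≡ P w
      zro-ne   : ∀ w → lab w ≡ zro → P w ≢ []
      zro-0    : ∀ w w₀ → lab w ≡ zro → Edge w 0 w₀ →
                   lab w₀ ≡ lam × P w₀ ∷ʳ w₀ ≡ P w
      succ-0   : ∀ w w₀ → lab w ≡ succ → Edge w 0 w₀ →
                   ∃ λ v → P w₀ ∷ʳ v ≡ P w
      succ-1   : ∀ w w₁ → lab w ≡ succ → Edge w 1 w₁ →
                   lab w₁ ≡ lam × P w₁ ∷ʳ w₁ ≡ P w

  IsLambdaTermGraph : Set
  IsLambdaTermGraph = ∃ λ P → IsAbsPrefix P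

  IsWalk : (n : ℕ) → (Fin (suc n) → V) → V → Set
  IsWalk n ws w = ws fzero ≡ w × (∀ (i : Fin n) → Succ (ws (inject₁ i)) (ws (fsuc i)))

  EagerScope : (V → List V) → Set
  EagerScope P = ∀ (w v : V) (p : List V) → P w ≡ p ∷ʳ v → ¬ (lab w ≡ succ) →
    ∃ λ (n : ℕ) → ∃ λ (ws : Fin (suc n) → V) →
      IsWalk n ws w
      × lab (ws (fromℕ n)) ≡ zro
      × Edge (ws (fromℕ n)) 0 v
      × (∀ (i : Fin (suc n)) → 1 ≤ toℕ i → toℕ i < n → (p ∷ʳ v) ≼ P (ws i))

  FullyBackLinked : (V → List V) → Set
  FullyBackLinked P = ∀ (w v : V) (p : List V) → P w ≡ p ∷ʳ v →
    ∃ λ (n : ℕ) → ∃ λ (ws : Fin (suc n) → V) →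
      IsWalk n ws w
      × Succ (ws (fromℕ n)) v
      × (∀ (i : Fin (suc n)) → (p ∷ʳ v) ≼ P (ws i))

-- Along an edge the abstraction prefix grows or stays the same, except at λ-targets and
-- along the 0-th edge of an S-vertex, where it loses its last entry. So the eager-scope
-- walk w → … → wₙ → v, whose inner vertices lie in the scope p v, ends in the 0-vertex wₙ,
-- which is still in scope unless its predecessor is an S-vertex u with prefix exactly p v.
-- In that case u itself points to v through its first edge, and the walk is cut before wₙ.
-- An S-vertex w in scope of v is handled by this first edge directly.
module Submission where

open import Defs
open import Data.List using (List; []; _∷_; _∷ʳ_)
open import Data.List.Properties using (++-conicalˡ; ∷ʳ-injective; ++-assoc; ++-identityʳ; ∷-injective)
open import Data.Nat using (ℕ; zero; suc; _≤_; _<_; s≤s; z≤n)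
open import Data.Fin using (Fin; toℕ; fromℕ; inject₁) renaming (zero to fzero; suc to fsuc)
open import Data.Fin.Properties using (inject₁ℕ<)
open import Data.Product using (∃; _×_; _,_; proj₁; proj₂)
open import Data.Sum using (_⊎_; inj₁; inj₂)
open import Relation.Binary.PropositionalEquality using (_≡_; refl; sym; trans; cong; cong₂; subst)
open import Relation.Nullary using (Dec; yes; no)
open import Function using (case_of_)

module _ {A : Set} where

  ≼-reflexive : ∀ {xs ys : List A} → xs ≡ ys → xs ≼ ys
  ≼-reflexive {xs} refl = [] , ++-identityʳ xs

  ≼-∷ʳ : ∀ {xs ys : List A} (u : A) → xs ≼ ys → xs ≼ (ys ∷ʳ u)
  ≼-∷ʳ {xs} u (zs , refl) = zs ∷ʳ u , sym (++-assoc xs zs (u ∷ []))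

  ≼-respʳ-≡ : ∀ {xs ys ys′ : List A} → ys ≡ ys′ → xs ≼ ys → xs ≼ ys′
  ≼-respʳ-≡ refl h = h

  ≼-∷ʳ⁻ : ∀ {xs ys : List A} {u : A} → xs ≼ (ys ∷ʳ u) → xs ≡ ys ∷ʳ u ⊎ xs ≼ ys
  ≼-∷ʳ⁻ {[]}     {ys}     (zs , eq) = inj₂ (ys , refl)
  ≼-∷ʳ⁻ {x ∷ xs} {[]}     (zs , eq) with ∷-injective eq
  ... | x≡u , xs++zs≡[] = inj₁ (cong₂ _∷_ x≡u (++-conicalˡ xs zs xs++zs≡[]))
  ≼-∷ʳ⁻ {x ∷ xs} {y ∷ ys} (zs , eq) with ∷-injective eq
  ... | x≡y , eq′ with ≼-∷ʳ⁻ {xs} {ys} (zs , eq′)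
  ... | inj₁ xs≡ys∷ʳu        = inj₁ (cong₂ _∷_ x≡y xs≡ys∷ʳu)
  ... | inj₂ (rs , xs++rs≡ys) = inj₂ (rs , cong₂ _∷_ x≡y xs++rs≡ys)

∀-inject₁-fromℕ : ∀ {n} {Q : Fin (suc n) → Set} →
                  (∀ j → Q (inject₁ j)) → Q (fromℕ n) → ∀ i → Q i
∀-inject₁-fromℕ {zero}  init last fzero    = last
∀-inject₁-fromℕ {suc n} init last fzero    = init fzero
∀-inject₁-fromℕ {suc n} init last (fsuc i) = ∀-inject₁-fromℕ (λ j → init (fsuc j)) last i

lab-cases : (l : Lab) → l ≡ app ⊎ l ≡ lam ⊎ l ≡ zro ⊎ l ≡ succ
lab-cases app  = inj₁ refl
lab-cases lam  = inj₂ (inj₁ refl)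
lab-cases zro  = inj₂ (inj₂ (inj₁ refl))
lab-cases succ = inj₂ (inj₂ (inj₂ refl))

≟succ : (l : Lab) → Dec (l ≡ succ)
≟succ app  = no λ ()
≟succ lam  = no λ ()
≟succ zro  = no λ ()
≟succ succ = yes refl

index-unary : ∀ {l} → l ≡ lam ⊎ l ≡ zro → (i : Fin (arity l)) → toℕ i ≡ 0
index-unary (inj₁ refl) fzero = refl
index-unary (inj₂ refl) fzero = refl

index-succ : ∀ {l} → l ≡ succ → (i : Fin (arity l)) → toℕ i ≡ 0 ⊎ toℕ i ≡ 1
index-succ refl fzero        = inj₁ refl
index-succ refl (fsuc fzero) = inj₂ refl

module _ (G : TermGraph) where
  open TermGraph G

  Edge-unary : ∀ {w k x} → lab w ≡ lam ⊎ lab w ≡ zro → Edge w k x → Edge w 0 x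
  Edge-unary l (i , _ , i↦x) = i , index-unary l i , i↦x

  Edge-succ : ∀ {w k x} → lab w ≡ succ → Edge w k x → Edge w 0 x ⊎ Edge w 1 x
  Edge-succ l (i , _ , i↦x) with index-succ l i
  ... | inj₁ i≡0 = inj₁ (i , i≡0 , i↦x)
  ... | inj₂ i≡1 = inj₂ (i , i≡1 , i↦x)

  Edge-succ-1 : ∀ {w} → lab w ≡ succ → ∃ λ x → Edge w 1 x
  Edge-succ-1 {w} l with lab w | args w
  Edge-succ-1 refl | succ | xs = _ , fsuc fzero , refl , refl

  IsWalk-init : ∀ {m w} (ws : Fin (suc (suc m)) → V) → IsWalk G (suc m) ws w → IsWalk G m (λ j → ws (inject₁ j)) w
  IsWalk-init ws (ws₀≡w , steps) = ws₀≡w , λ i → steps (inject₁ i)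

  module Scope (P : V → List V) (AP : IsAbsPrefix G P) where
    open IsAbsPrefix AP

    ScopedWalk : V → V → List V → Set
    ScopedWalk w v q = ∃ λ (n : ℕ) → ∃ λ (ws : Fin (suc n) → V) →
      IsWalk G n ws w × Succ (ws (fromℕ n)) v × (∀ (i : Fin (suc n)) → q ≼ P (ws i))

    ScopedWalk-edge : ∀ {w v q} → P w ≡ q → Succ w v → ScopedWalk w v q
    ScopedWalk-edge Pw≡q w↣v = 0 , (λ _ → _) , (refl , λ ()) , w↣v , λ _ → ≼-reflexive (sym Pw≡q)

    succ-Succ-last : ∀ {w v p} → lab w ≡ succ → P w ≡ p ∷ʳ v → Succ w v
    succ-Succ-last {w} l Pw≡pv with Edge-succ-1 l
    ... | x , w↣₁x =
      1 , subst (Edge w 1) (proj₂ (∷ʳ-injective _ _ (trans (proj₂ (succ-1 w x l w↣₁x)) Pw≡pv))) w↣₁x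

    Succ-zro-≼ : ∀ {q u x} → Succ u x → lab x ≡ zro → q ≼ P u →
                 q ≼ P x ⊎ lab u ≡ succ × P u ≡ q
    Succ-zro-≼ {q} {u} {x} (k , u↣x) x-zro q≼Pu with lab-cases (lab u)
    ... | inj₁ l = inj₁ (≼-respʳ-≡ (sym (app-k u k x l u↣x)) q≼Pu)
    ... | inj₂ (inj₁ l) = inj₁ (≼-respʳ-≡ (sym (lam-0 u x l (Edge-unary (inj₁ l) u↣x))) (≼-∷ʳ u q≼Pu))
    ... | inj₂ (inj₂ (inj₁ l)) with () ← trans (sym x-zro) (proj₁ (zro-0 u x l (Edge-unary (inj₂ l) u↣x)))
    ... | inj₂ (inj₂ (inj₂ l)) with Edge-succ l u↣x
    ...   | inj₂ u↣₁x with () ← trans (sym x-zro) (proj₁ (succ-1 u x l u↣₁x))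
    ...   | inj₁ u↣₀x with succ-0 u x l u↣₀x
    ...     | y , Px∷ʳy≡Pu with ≼-∷ʳ⁻ (≼-respʳ-≡ (sym Px∷ʳy≡Pu) q≼Pu)
    ...       | inj₁ q≡Pu = inj₂ (l , trans (sym Px∷ʳy≡Pu) (sym q≡Pu))
    ...       | inj₂ q≼Px = inj₁ q≼Px

    prefix-before-last : ∀ {n w q} (ws : Fin (suc n) → V) → IsWalk G n ws w → P w ≡ q →
      (∀ (i : Fin (suc n)) → 1 ≤ toℕ i → toℕ i < n → q ≼ P (ws i)) →
      ∀ (j : Fin n) → q ≼ P (ws (inject₁ j))
    prefix-before-last ws (ws₀≡w , _) Pw≡q inner fzero    = ≼-reflexive (sym (trans (cong P ws₀≡w) Pw≡q))
    prefix-before-last ws _           _    inner (fsuc j) = inner (inject₁ (fsuc j)) (s≤s z≤n) (inject₁ℕ< (fsuc j))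

    eager-ScopedWalk : ∀ {w v p n} (ws : Fin (suc n) → V) → P w ≡ p ∷ʳ v → IsWalk G n ws w →
      lab (ws (fromℕ n)) ≡ zro → Edge (ws (fromℕ n)) 0 v →
      (∀ (j : Fin n) → (p ∷ʳ v) ≼ P (ws (inject₁ j))) → ScopedWalk w v (p ∷ʳ v)
    eager-ScopedWalk {n = zero} ws Pw≡pv walk@(ws₀≡w , _) _ ws₀↣v _ =
      0 , ws , walk , (0 , ws₀↣v) , λ { fzero → ≼-reflexive (sym (trans (cong P ws₀≡w) Pw≡pv)) }
    eager-ScopedWalk {n = suc m} ws Pw≡pv walk@(_ , steps) last-zro last↣v before
      with Succ-zro-≼ (steps (fromℕ m)) last-zro (before (fromℕ m))
    ... | inj₁ in-scope = suc m , ws , walk , (0 , last↣v) , ∀-inject₁-fromℕ before in-scope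
    ... | inj₂ (u-succ , Pu≡pv) =
      m , (λ j → ws (inject₁ j)) , IsWalk-init ws walk , succ-Succ-last u-succ Pu≡pv , before

proposition7p2 : (G : TermGraph) (P : TermGraph.V G → List (TermGraph.V G)) →
    IsAbsPrefix G P → EagerScope G P → FullyBackLinked G P
proposition7p2 G P AP eager w v p Pw≡pv = case ≟succ (lab w) of λ where
    (yes w-succ) → ScopedWalk-edge Pw≡pv (succ-Succ-last w-succ Pw≡pv)
    (no ¬w-succ) →
      let n , ws , walk , last-zro , last↣v , inner = eager w v p Pw≡pv ¬w-succ
      in eager-ScopedWalk ws Pw≡pv walk last-zro last↣v (prefix-before-last ws walk Pw≡pv inner)
  where
  open TermGraph G
  open Scope G P AP
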